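{- Let $n\geq 3$. The set of permutations $\pi=\pi_1\cdots\pi_n\in\mathcal{S}_n$ such that $\pi$ avoids both $213$ and $312$, $\pi^2$ avoids the consecutive pattern $\overline{213}$, and $\pi_n=1$, consists exactly of the permutation $23\cdots n1$ together with all permutations of the form $\sigma\, n\,(n-1)\,\tau\,1$ (concatenation of words), where $\sigma$ is a (possibly empty) increasing word and $\tau$ is a (possibly empty) decreasing word.
   Context: $\mathcal{S}_n$ is the set of permutations of $[n]$, written as words with $\pi_i=\pi(i)$; $\pi^2=\pi\circ\pi$. A permutation contains a pattern $\sigma\in\mathcal{S}_k$ if some (not necessarily consecutive) subsequence of length $k$ is order isomorphic to $\sigma$; otherwise it avoids it. A permutation $\pi$ contains the consecutive pattern $\overline{213}$ if there is an index $i$ with $\pi_{i+1}<\pi_i<\pi_{i+2}$; otherwise it avoids it. -}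

module Defs where

open import Data.Nat using (ℕ; zero; suc; _+_; _∸_; _≤_; _<_; _>_)
open import Data.Fin using (Fin; toℕ) renaming (_<_ to _<ᶠ_)
open import Data.Fin.Permutation using (Permutation′; _⟨$⟩ʳ_)
open import Data.List using (List; map; upTo)
open import Data.List.Relation.Unary.Linked using (Linked)
open import Data.Product using (Σ; ∃; _×_)
open import Data.Sum using (_⊎_)
open import Function.Bundles using (_⇔_)
open import Relation.Nullary using (¬_)

-- A permutation of [n], given by its values as a function Fin n → Fin n
-- (values are 0-based internally: value v stands for v+1).
Perm : ℕ → Set
Perm = Permutation′

sq : ∀ {n} → Perm n → Fin n → Fin n
sq π i = π ⟨$⟩ʳ (π ⟨$⟩ʳ i)

Contains : ∀ {n k} → (Fin n → Fin n) → (Fin k → Fin k) → Set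
Contains {n} {k} w σ =
  Σ (Fin k → Fin n) λ e →
    (∀ a b → a <ᶠ b → e a <ᶠ e b) ×
    (∀ a b → (σ a <ᶠ σ b → w (e a) <ᶠ w (e b)) × (w (e a) <ᶠ w (e b) → σ a <ᶠ σ b))

Avoids : ∀ {n k} → (Fin n → Fin n) → (Fin k → Fin k) → Set
Avoids w σ = ¬ Contains w σ

p213 : Fin 3 → Fin 3
p213 Fin.zero = Fin.suc Fin.zero
p213 (Fin.suc Fin.zero) = Fin.zero
p213 (Fin.suc (Fin.suc Fin.zero)) = Fin.suc (Fin.suc Fin.zero)

p312 : Fin 3 → Fin 3
p312 Fin.zero = Fin.suc (Fin.suc Fin.zero)
p312 (Fin.suc Fin.zero) = Fin.zero
p312 (Fin.suc (Fin.suc Fin.zero)) = Fin.suc Fin.zero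

ContainsConsec213 : ∀ {n} → (Fin n → Fin n) → Set
ContainsConsec213 {n} w =
  Σ ℕ λ i → Σ (suc (suc i) < n) λ h →
    let a = toℕ (w (Data.Fin.fromℕ< {i} (lemma0 h)))
        b = toℕ (w (Data.Fin.fromℕ< {suc i} (lemma1 h)))
        c = toℕ (w (Data.Fin.fromℕ< h))
    in b < a × a < c
  where
  open import Data.Nat.Properties using (<-trans; n<1+n)
  lemma1 : ∀ {i n} → suc (suc i) < n → suc i < n
  lemma1 h = <-trans (n<1+n _) h
  lemma0 : ∀ {i n} → suc (suc i) < n → i < n
  lemma0 h = <-trans (n<1+n _) (lemma1 h)

AvoidsConsec213 : ∀ {n} → (Fin n → Fin n) → Set
AvoidsConsec213 w = ¬ ContainsConsec213 w

word : ∀ {n} → Perm n → List ℕ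
word {n} π = map (λ i → suc (toℕ (π ⟨$⟩ʳ i))) (Data.List.allFin n)

Increasing : List ℕ → Set
Increasing = Linked _<_

Decreasing : List ℕ → Set
Decreasing = Linked _>_

-- Avoiding 213 and 312 means having no valley: π rises to its maximum n and then falls, so with
-- π_n = 1 it reads σ n τ′ 1. If n stands at position n − 1 this is 23⋯n1. Otherwise look at the
-- value n − 1. It cannot come after the entry z following n, as the run after n falls; before n
-- it must stand immediately before n, and then π² takes the values π(n − 1), π(n) = 1, π(z) at
-- these three consecutive positions, a consecutive 213 since π(n − 1) < π(z). So z = n − 1.
-- Conversely, for both shapes π is unimodal: three consecutive entries away from the peak are
-- monotone, so a consecutive 213 of π² there would be a valley of π, and across the peak the
-- three values of π² are compared directly.

module Submission where

open import Data.Nat using (ℕ; zero; suc; _+_; _≤_; _<_; z≤n; s≤s; s≤s⁻¹; z<s; _≤?_; _<?_)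
open import Data.Nat.Properties
open import Data.Fin using (Fin; zero; fromℕ; fromℕ<; toℕ) renaming (_<_ to _<ᶠ_)
open import Data.Fin.Patterns using (0F; 1F; 2F)
open import Data.Fin.Properties
  using (toℕ<n; toℕ-fromℕ; toℕ-fromℕ<; fromℕ<-toℕ; toℕ-injective) renaming (<-cmp to <ᶠ-cmp)
open import Data.Fin.Permutation using (_⟨$⟩ʳ_; _⟨$⟩ˡ_; inverseˡ; inverseʳ)
open import Data.List using (List; []; _∷_; _++_; _∷ʳ_; map; upTo; applyUpTo; tabulate; length)
open import Data.List.Properties
  using (∷-injective; ∷ʳ-injective; applyUpTo-∷ʳ; map-upTo; map-tabulate; length-++; length-applyUpTo)
open import Data.List.Relation.Unary.Linked using (Linked; _∷_)
open import Data.List.Relation.Unary.Linked.Properties using (applyUpTo⁺₁)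
open import Data.Product using (Σ; ∃-syntax; _×_; _,_; proj₁; proj₂; map₁; uncurry)
open import Data.Sum using (_⊎_; inj₁; inj₂; [_,_])
open import Data.Empty using (⊥; ⊥-elim)
open import Function using (_∘_; id)
open import Function.Bundles using (_⇔_; mk⇔; module Equivalence)
open import Relation.Nullary using (yes; no)
open import Relation.Binary using (tri<; tri≈; tri>)
open import Relation.Binary.PropositionalEquality
  using (_≡_; _≢_; refl; sym; trans; cong; cong₂; subst; subst₂; ≢-sym; module ≡-Reasoning)

open import Defs

Ascending : (ℕ → ℕ) → ℕ → Set
Ascending F P = ∀ {i j} → i < j → j ≤ P → F i < F j

Descending : (ℕ → ℕ) → ℕ → ℕ → Set
Descending F P m = ∀ {i j} → P ≤ i → i < j → j ≤ m → F j < F i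

ValleyFree : ℕ → (ℕ → ℕ) → Set
ValleyFree m F = ∀ {i j k} → i < j → j < k → k ≤ m → F j < F i → F j < F k → ⊥

Consecutive213Free : ℕ → (ℕ → ℕ) → Set
Consecutive213Free m G = ∀ i → suc (suc i) ≤ m → G (suc i) < G i → G i < G (suc (suc i)) → ⊥

module Unimodal (F : ℕ → ℕ) where

  unimodal⇒valleyFree : ∀ {P m} → Ascending F P → Descending F P m → ValleyFree m F
  unimodal⇒valleyFree {P} asc desc {j = j} i<j j<k k≤m Fj<Fi Fj<Fk with j ≤? P
  ... | yes j≤P = <-asym Fj<Fi (asc i<j j≤P)
  ... | no  j≰P = <-asym Fj<Fk (desc (<⇒≤ (≰⇒> j≰P)) j<k k≤m)

  ascending-steps : ∀ {P} → (∀ {j} → suc j ≤ P → F j < F (suc j)) → Ascending F P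
  ascending-steps step {i} {suc j} (s≤s i≤j) j<P with m≤n⇒m<n∨m≡n i≤j
  ... | inj₁ i<j  = <-trans (ascending-steps step i<j (<⇒≤ j<P)) (step j<P)
  ... | inj₂ refl = step j<P

  descending-steps : ∀ {P m} → (∀ {j} → P ≤ j → suc j ≤ m → F (suc j) < F j) → Descending F P m
  descending-steps step {i} {suc j} P≤i (s≤s i≤j) j<m with m≤n⇒m<n∨m≡n i≤j
  ... | inj₁ i<j  = <-trans (step (≤-trans P≤i i≤j) j<m) (descending-steps step P≤i i<j (<⇒≤ j<m))
  ... | inj₂ refl = step P≤i j<m

  descending-≤ : ∀ {P m i j} → Descending F P m → P ≤ i → i ≤ j → j ≤ m → F j ≤ F i
  descending-≤ desc P≤i i≤j j≤m with m≤n⇒m<n∨m≡n i≤j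
  ... | inj₁ i<j  = <⇒≤ (desc P≤i i<j j≤m)
  ... | inj₂ refl = ≤-refl

  ascending-spread : ∀ {P} → Ascending F P → ∀ i d → i + d ≤ P → F i + d ≤ F (i + d)
  ascending-spread asc i zero _ rewrite +-identityʳ i | +-identityʳ (F i) = ≤-refl
  ascending-spread asc i (suc d) i+1+d≤P = begin
    F i + suc d     ≡⟨ +-suc (F i) d ⟩
    suc (F i + d)   ≤⟨ s≤s (ascending-spread asc i d (<⇒≤ (<-≤-trans i+d<i+1+d i+1+d≤P))) ⟩
    suc (F (i + d)) ≤⟨ asc i+d<i+1+d i+1+d≤P ⟩
    F (i + suc d)   ∎
    where
    open ≤-Reasoning
    i+d<i+1+d = +-monoʳ-< i (n<1+n d)

  ascending-above-index : ∀ {P j} → Ascending F P → 1 ≤ F 0 → j ≤ P → suc j ≤ F j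
  ascending-above-index asc F0>0 j≤P = ≤-trans (+-monoˡ-≤ _ F0>0) (ascending-spread asc 0 _ j≤P)

  ascending-squeeze : ∀ {P j} → Ascending F P → 1 ≤ F 0 → F P ≤ suc P → j ≤ P → F j ≡ suc j
  ascending-squeeze {P} {j} asc F0>0 FP≤1+P j≤P = ≤-antisym upper (ascending-above-index asc F0>0 j≤P)
    where
    d = proj₁ (m≤n⇒∃[o]m+o≡n j≤P)
    j+d≡P : j + d ≡ P
    j+d≡P = proj₂ (m≤n⇒∃[o]m+o≡n j≤P)
    upper : F j ≤ suc j
    upper = +-cancelʳ-≤ d (F j) (suc j) (begin
      F j + d   ≤⟨ ascending-spread asc j d (≤-reflexive j+d≡P) ⟩
      F (j + d) ≡⟨ cong F j+d≡P ⟩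
      F P       ≤⟨ FP≤1+P ⟩
      suc P     ≡⟨ cong suc (sym j+d≡P) ⟩
      suc j + d ∎)
      where open ≤-Reasoning

  ascending-before-peak : ∀ {P k q} → Ascending F P → F P ≡ suc q → F k ≡ q → k < P → suc k ≡ P
  ascending-before-peak {k = k} asc FP≡1+q Fk≡q k<P with m≤n⇒m<n∨m≡n k<P
  ... | inj₂ 1+k≡P = 1+k≡P
  ... | inj₁ 1+k<P = ⊥-elim (<⇒≱ q<F[1+k] (≤-pred (subst (F (suc k) <_) FP≡1+q (asc 1+k<P ≤-refl))))
    where
    q<F[1+k] = subst (_< F (suc k)) Fk≡q (asc ≤-refl (<⇒≤ 1+k<P))

  unimodal⇒sq-consecutive213Free : ∀ {P m} → Ascending F P → Descending F P m →
    (∀ {i} → i ≤ m → F i ≤ m) → (∀ {k} → suc k ≡ P → F (F (suc P)) < F (F k)) →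
    Consecutive213Free m (F ∘ F)
  unimodal⇒sq-consecutive213Free {P} asc desc bounded crossing i i+2≤m b<a a<c with <-cmp (suc i) P
  ... | tri< i+1<P _ _ =
    valleyFree (asc ≤-refl (<⇒≤ i+1<P)) (asc ≤-refl i+1<P) (bounded i+2≤m) b<a (<-trans b<a a<c)
    where valleyFree = unimodal⇒valleyFree asc desc
  ... | tri≈ _ i+1≡P _ = <-asym a<c (subst (λ x → F (F (suc x)) < F (F i)) (sym i+1≡P) (crossing i+1≡P))
  ... | tri> _ _ P<i+1 =
    valleyFree (desc (<⇒≤ P<i+1) ≤-refl i+2≤m) (desc (≤-pred P<i+1) ≤-refl (<⇒≤ i+2≤m))
      (bounded (<⇒≤ (<⇒≤ i+2≤m))) (<-trans b<a a<c) b<a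
    where valleyFree = unimodal⇒valleyFree asc desc

record IsPermutation (m : ℕ) (F : ℕ → ℕ) : Set where
  field
    bounded    : ∀ {i} → i ≤ m → F i ≤ m
    injective  : ∀ {i j} → i ≤ m → j ≤ m → F i ≡ F j → i ≡ j
    surjective : ∀ {v} → v ≤ m → ∃[ i ] i ≤ m × F i ≡ v

  injective-≢ : ∀ {i j} → i ≤ m → j ≤ m → i ≢ j → F i ≢ F j
  injective-≢ i≤m j≤m i≢j = i≢j ∘ injective i≤m j≤m

  below-max : ∀ {P j} → P ≤ m → F P ≡ m → j ≤ m → j ≢ P → F j < m
  below-max P≤m FP≡m j≤m j≢P =
    ≤∧≢⇒< (bounded j≤m) (λ Fj≡m → injective-≢ j≤m P≤m j≢P (trans Fj≡m (sym FP≡m)))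

  above-zero : ∀ {z j} → z ≤ m → F z ≡ 0 → j ≤ m → j ≢ z → 0 < F j
  above-zero z≤m Fz≡0 j≤m j≢z = n≢0⇒n>0 (λ Fj≡0 → injective-≢ j≤m z≤m j≢z (trans Fj≡0 (sym Fz≡0)))

  valleyFree⇒ascending : ∀ {P} → ValleyFree m F → P ≤ m → F P ≡ m → Ascending F P
  valleyFree⇒ascending {P} valleyFree P≤m FP≡m {i} {j} i<j j≤P with <-cmp (F i) (F j)
  ... | tri< Fi<Fj _ _ = Fi<Fj
  ... | tri≈ _ Fi≡Fj _ = ⊥-elim (<⇒≢ i<j (injective i≤m j≤m Fi≡Fj))
    where
    j≤m = ≤-trans j≤P P≤m
    i≤m = <⇒≤ (<-≤-trans i<j j≤m)
  ... | tri> _ _ Fj<Fi with m≤n⇒m<n∨m≡n j≤P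
  ...   | inj₂ refl = ⊥-elim (<⇒≱ Fj<Fi (subst (F i ≤_) (sym FP≡m) (bounded (<⇒≤ (<-≤-trans i<j P≤m)))))
  ...   | inj₁ j<P  = ⊥-elim (
    valleyFree i<j j<P P≤m Fj<Fi
      (subst (F j <_) (sym FP≡m) (below-max P≤m FP≡m (<⇒≤ (<-≤-trans j<P P≤m)) (<⇒≢ j<P))))

  valleyFree⇒descending : ∀ {P} → ValleyFree m F → P ≤ m → F P ≡ m → Descending F P m
  valleyFree⇒descending {P} valleyFree P≤m FP≡m {i} {j} P≤i i<j j≤m with <-cmp (F j) (F i)
  ... | tri< Fj<Fi _ _ = Fj<Fi
  ... | tri≈ _ Fj≡Fi _ = ⊥-elim (<⇒≢ i<j (injective (<⇒≤ (<-≤-trans i<j j≤m)) j≤m (sym Fj≡Fi)))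
  ... | tri> _ _ Fi<Fj with m≤n⇒m<n∨m≡n P≤i
  ...   | inj₂ refl = ⊥-elim (<⇒≱ Fi<Fj (subst (F j ≤_) (sym FP≡m) (bounded j≤m)))
  ...   | inj₁ P<i  = ⊥-elim (
    valleyFree P<i i<j j≤m
      (subst (F i <_) (sym FP≡m) (below-max P≤m FP≡m (<⇒≤ (<-≤-trans i<j j≤m)) (≢-sym (<⇒≢ P<i)))) Fi<Fj)

-- The shapes 2 3 ⋯ n 1 and σ n (n − 1) τ 1 in 0-based values, where n = q + 2; the final value 0
-- is stated separately.
Rotation : ℕ → (ℕ → ℕ) → Set
Rotation q F = ∀ {j} → j ≤ q → F j ≡ suc j

record PeakShape (q : ℕ) (F : ℕ → ℕ) : Set where
  field
    peak             : ℕ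
    peak<q           : peak < q
    at-peak          : F peak ≡ suc q
    after-peak       : F (suc peak) ≡ q
    ascending-before : ∀ {j} → suc j < peak → F j < F (suc j)
    descending-after : ∀ {j} → suc peak < j → j < q → F (suc j) < F j

module PeakAnalysis {q F} (perm : IsPermutation (suc q) F) (F-last : F (suc q) ≡ 0) where
  open IsPermutation perm
  open Unimodal F

  F-first-positive : 1 ≤ F 0
  F-first-positive = above-zero ≤-refl F-last z≤n (λ ())

  peak-successor : ∀ {P} → Ascending F P → Descending F P (suc q) → Consecutive213Free (suc q) (F ∘ F) →
    F P ≡ suc q → P < q → F (suc P) ≡ q
  peak-successor {P} asc desc c213 FP≡1+q P<q with surjective (n≤1+n q)
  ... | k , k≤1+q , Fk≡q with <-cmp k (suc P)
  ... | tri≈ _ refl _ = Fk≡q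
  ... | tri> _ _ 1+P<k = ⊥-elim (<⇒≱ q<z (≤-pred z<1+q))
    where
    q<z = subst (_< F (suc P)) Fk≡q (desc (n≤1+n P) 1+P<k k≤1+q)
    z<1+q = below-max (≤-trans (<⇒≤ P<q) (n≤1+n q)) FP≡1+q (s≤s (<⇒≤ P<q)) (λ ())
  ... | tri< k<1+P _ _ = ⊥-elim (c213 k 2+k≤1+q FF[1+k]<FFk FFk<FF[2+k])
    where
    P≤1+q = ≤-trans (<⇒≤ P<q) (n≤1+n q)
    k<P : k < P
    k<P = ≤∧≢⇒< (≤-pred k<1+P) λ { refl → <-irrefl (trans (sym Fk≡q) FP≡1+q) ≤-refl }
    1+k≡P = ascending-before-peak asc FP≡1+q Fk≡q k<P
    2+k≤1+q = subst (λ x → suc x ≤ suc q) (sym 1+k≡P) (s≤s (<⇒≤ P<q))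
    z = F (suc P)
    z<q : z < q
    z<q = ≤∧≢⇒< (≤-pred (below-max P≤1+q FP≡1+q (s≤s (<⇒≤ P<q)) λ ()))
                 (λ z≡q → <-irrefl (sym (injective (s≤s (<⇒≤ P<q)) k≤1+q (trans z≡q (sym Fk≡q)))) k<1+P)
    Fq<Fz : F q < F z
    Fq<Fz with z ≤? P
    ... | yes z≤P = ≤-<-trans (descending-≤ desc (n≤1+n P) P<q (n≤1+n q))
                              (ascending-above-index asc F-first-positive z≤P)
    ... | no  z≰P = desc (<⇒≤ (≰⇒> z≰P)) z<q (n≤1+n q)
    FF[1+k]<FFk : F (F (suc k)) < F (F k)
    FF[1+k]<FFk = subst₂ _<_ (sym (trans (cong F (trans (cong F 1+k≡P) FP≡1+q)) F-last)) (cong F (sym Fk≡q))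
                    (above-zero ≤-refl F-last (n≤1+n q) (λ q≡1+q → <-irrefl q≡1+q ≤-refl))
    FFk<FF[2+k] : F (F k) < F (F (suc (suc k)))
    FFk<FF[2+k] = subst₂ _<_ (cong F (sym Fk≡q)) (cong (λ x → F (F (suc x))) (sym 1+k≡P)) Fq<Fz

  unimodal⇒patternFree : ∀ {P} → Ascending F P → Descending F P (suc q) →
    (∀ {k} → suc k ≡ P → F (F (suc P)) < F (F k)) →
    ValleyFree (suc q) F × Consecutive213Free (suc q) (F ∘ F)
  unimodal⇒patternFree asc desc crossing =
    unimodal⇒valleyFree asc desc , unimodal⇒sq-consecutive213Free asc desc bounded crossing

  shape-from-peak : ∀ {P} → Consecutive213Free (suc q) (F ∘ F) →
    P ≤ suc q → F P ≡ suc q → Ascending F P → Descending F P (suc q) → Rotation q F ⊎ PeakShape q F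
  shape-from-peak {P} c213 P≤1+q FP≡1+q asc desc with m≤n⇒m<n∨m≡n P≤1+q
  ... | inj₂ refl = ⊥-elim (0≢1+n (trans (sym F-last) FP≡1+q))
  ... | inj₁ P<1+q with m≤n⇒m<n∨m≡n (≤-pred P<1+q)
  ...   | inj₂ refl = inj₁ (ascending-squeeze asc F-first-positive (≤-reflexive FP≡1+q))
  ...   | inj₁ P<q  = inj₂ record
    { peak             = P
    ; peak<q           = P<q
    ; at-peak          = FP≡1+q
    ; after-peak       = peak-successor asc desc c213 FP≡1+q P<q
    ; ascending-before = λ 1+j<P → asc ≤-refl (<⇒≤ 1+j<P)
    ; descending-after = λ 1+P<j j<q → desc (<⇒≤ (<-trans (n<1+n P) 1+P<j)) ≤-refl (s≤s (<⇒≤ j<q))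
    }

  patternFree⇒shape : ValleyFree (suc q) F → Consecutive213Free (suc q) (F ∘ F) → Rotation q F ⊎ PeakShape q F
  patternFree⇒shape valleyFree c213 with surjective (≤-refl {suc q})
  ... | _ , P≤1+q , FP≡1+q = shape-from-peak c213 P≤1+q FP≡1+q
    (valleyFree⇒ascending valleyFree P≤1+q FP≡1+q) (valleyFree⇒descending valleyFree P≤1+q FP≡1+q)

  rotation⇒patternFree : Rotation q F →
    ValleyFree (suc q) F × Consecutive213Free (suc q) (F ∘ F)
  rotation⇒patternFree rotation = unimodal⇒patternFree asc desc crossing
    where
    asc : Ascending F q
    asc i<j j≤q = subst₂ _<_ (sym (rotation (<⇒≤ (<-≤-trans i<j j≤q)))) (sym (rotation j≤q)) (s≤s i<j)
    desc : Descending F q (suc q)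
    desc {i} {j} q≤i i<j j≤1+q = subst₂ _<_ (sym (trans (cong F j≡1+q) F-last)) (sym (rotation i≤q)) (s≤s z≤n)
      where
      j≡1+q = ≤-antisym j≤1+q (≤-<-trans q≤i i<j)
      i≤q = ≤-pred (<-≤-trans i<j j≤1+q)
    crossing : ∀ {k} → suc k ≡ q → F (F (suc q)) < F (F k)
    crossing {k} 1+k≡q = subst₂ _<_
      (sym (trans (cong F F-last) (rotation z≤n)))
      (sym (trans (cong F (rotation (<⇒≤ k<q))) (rotation (≤-reflexive 1+k≡q))))
      (s≤s (s≤s z≤n))
      where k<q = ≤-reflexive 1+k≡q

  peakShape⇒patternFree : PeakShape q F → ValleyFree (suc q) F × Consecutive213Free (suc q) (F ∘ F)
  peakShape⇒patternFree shape = unimodal⇒patternFree asc desc crossing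
    where
    open PeakShape shape renaming (peak to P; peak<q to P<q; at-peak to FP≡1+q; after-peak to F[1+P]≡q;
                                   ascending-before to σ-steps; descending-after to τ-steps)
    P≤1+q = ≤-trans (<⇒≤ P<q) (n≤1+n q)
    1+P≤1+q = s≤s (<⇒≤ P<q)
    asc : Ascending F P
    asc = ascending-steps step
      where
      step : ∀ {j} → suc j ≤ P → F j < F (suc j)
      step {j} 1+j≤P with m≤n⇒m<n∨m≡n 1+j≤P
      ... | inj₁ 1+j<P = σ-steps 1+j<P
      ... | inj₂ 1+j≡P = subst (F j <_) (sym (trans (cong F 1+j≡P) FP≡1+q))
                           (below-max P≤1+q FP≡1+q (<⇒≤ (<-≤-trans 1+j≤P P≤1+q)) (<⇒≢ 1+j≤P))
    desc : Descending F P (suc q)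
    desc = descending-steps step
      where
      step : ∀ {j} → P ≤ j → suc j ≤ suc q → F (suc j) < F j
      step {j} P≤j 1+j≤1+q with m≤n⇒m<n∨m≡n P≤j
      ... | inj₂ refl = subst₂ _<_ (sym F[1+P]≡q) (sym FP≡1+q) ≤-refl
      ... | inj₁ P<j with m≤n⇒m<n∨m≡n P<j
      ...   | inj₂ refl = subst (F (suc (suc P)) <_) (sym F[1+P]≡q) (≤∧≢⇒< F[2+P]≤q F[2+P]≢q)
        where
        F[2+P]≤q = ≤-pred (below-max P≤1+q FP≡1+q 1+j≤1+q
                     (λ 2+P≡P → <-irrefl (sym 2+P≡P) (<-trans (n<1+n P) (n<1+n (suc P)))))
        F[2+P]≢q = λ F[2+P]≡q → <-irrefl (injective 1+P≤1+q 1+j≤1+q (trans F[1+P]≡q (sym F[2+P]≡q))) ≤-refl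
      ...   | inj₁ 1+P<j with m≤n⇒m<n∨m≡n 1+j≤1+q
      ...     | inj₁ 1+j<1+q = τ-steps 1+P<j (≤-pred 1+j<1+q)
      ...     | inj₂ 1+j≡1+q = subst (_< F j) (sym (trans (cong F 1+j≡1+q) F-last))
                                 (above-zero ≤-refl F-last (<⇒≤ 1+j≤1+q) (<⇒≢ 1+j≤1+q))
    crossing : ∀ {k} → suc k ≡ P → F (F (suc P)) < F (F k)
    crossing {k} 1+k≡P = subst (λ x → F x < F (F k)) (sym F[1+P]≡q) (desc P≤Fk Fk<q (n≤1+n q))
      where
      k<P = ≤-reflexive 1+k≡P
      k≤1+q = <⇒≤ (<-≤-trans k<P P≤1+q)
      P≤Fk = subst (_≤ F k) 1+k≡P (ascending-above-index asc F-first-positive (<⇒≤ k<P))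
      Fk<q = ≤∧≢⇒< (≤-pred (below-max P≤1+q FP≡1+q k≤1+q (<⇒≢ k<P)))
               (injective-≢ k≤1+q 1+P≤1+q (<⇒≢ (m<n⇒m<1+n k<P)) ∘ (λ Fk≡q → trans Fk≡q (sym F[1+P]≡q)))

  patternFree⇔shape : (ValleyFree (suc q) F × Consecutive213Free (suc q) (F ∘ F)) ⇔ (Rotation q F ⊎ PeakShape q F)
  patternFree⇔shape = mk⇔ (uncurry patternFree⇒shape) [ rotation⇒patternFree , peakShape⇒patternFree ]

StrictlyIncreasing : ∀ {k} → (Fin k → ℕ) → Set
StrictlyIncreasing g = ∀ a b → a <ᶠ b → g a < g b

strictlyIncreasing-reflects : ∀ {k} {g : Fin k → ℕ} → StrictlyIncreasing g → ∀ a b → g a < g b → a <ᶠ b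
strictlyIncreasing-reflects g↑ a b ga<gb with <ᶠ-cmp a b
... | tri< a<b _ _ = a<b
... | tri≈ _ refl _ = ⊥-elim (<-irrefl refl ga<gb)
... | tri> _ _ b<a = ⊥-elim (<-asym ga<gb (g↑ b a b<a))

contains-by-ranking : ∀ {n k} (w : Fin n → Fin n) (σ : Fin k → Fin k) (e : Fin k → Fin n) (g : Fin k → ℕ) →
  StrictlyIncreasing (toℕ ∘ e) → StrictlyIncreasing g → (∀ a → toℕ (w (e a)) ≡ g (σ a)) → Contains w σ
contains-by-ranking w σ e g e↑ g↑ ranked = e , e↑ , λ a b →
  (λ σa<σb → subst₂ _<_ (sym (ranked a)) (sym (ranked b)) (g↑ (σ a) (σ b) σa<σb)) ,
  (λ wa<wb → strictlyIncreasing-reflects g↑ (σ a) (σ b) (subst₂ _<_ (ranked a) (ranked b) wa<wb))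

triple : ℕ → ℕ → ℕ → Fin 3 → ℕ
triple x y z 0F = x
triple x y z 1F = y
triple x y z 2F = z

triple-increasing : ∀ {x y z} → x < y → y < z → StrictlyIncreasing (triple x y z)
triple-increasing x<y y<z 0F 1F _ = x<y
triple-increasing x<y y<z 0F 2F _ = <-trans x<y y<z
triple-increasing x<y y<z 1F 2F _ = y<z
triple-increasing x<y y<z 0F 0F ()
triple-increasing x<y y<z 1F 0F ()
triple-increasing x<y y<z 1F 1F (s≤s ())
triple-increasing x<y y<z 2F 0F ()
triple-increasing x<y y<z 2F 1F (s≤s ())
triple-increasing x<y y<z 2F 2F (s≤s (s≤s ()))

module _ {A : Set} where

  tabulate-applyUpTo : ∀ {n} (f : Fin n → A) (g : ℕ → A) → (∀ i → f i ≡ g (toℕ i)) → tabulate f ≡ applyUpTo g n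
  tabulate-applyUpTo {zero}  f g f≗g = refl
  tabulate-applyUpTo {suc n} f g f≗g = cong₂ _∷_ (f≗g 0F) (tabulate-applyUpTo (f ∘ Fin.suc) (g ∘ suc) (f≗g ∘ Fin.suc))

  applyUpTo-cong : ∀ {f g : ℕ → A} n → (∀ {j} → j < n → f j ≡ g j) → applyUpTo f n ≡ applyUpTo g n
  applyUpTo-cong zero    f≗g = refl
  applyUpTo-cong (suc n) f≗g = cong₂ _∷_ (f≗g z<s) (applyUpTo-cong n (f≗g ∘ s≤s))

  applyUpTo-injective : ∀ (f g : ℕ → A) n → applyUpTo f n ≡ applyUpTo g n → ∀ {j} → j < n → f j ≡ g j
  applyUpTo-injective f g (suc n) eq {zero}  _         = proj₁ (∷-injective eq)
  applyUpTo-injective f g (suc n) eq {suc j} (s≤s j<n) =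
    applyUpTo-injective (f ∘ suc) (g ∘ suc) n (proj₂ (∷-injective eq)) j<n

  applyUpTo-++ : ∀ (f : ℕ → A) a b → applyUpTo f (a + b) ≡ applyUpTo f a ++ applyUpTo (λ j → f (a + j)) b
  applyUpTo-++ f zero    b = refl
  applyUpTo-++ f (suc a) b = cong (f 0 ∷_) (applyUpTo-++ (f ∘ suc) a b)

  applyUpTo-peak : ∀ (f : ℕ → A) P T → applyUpTo f (P + suc (suc (suc T))) ≡
    applyUpTo f P ++ (f (P + 0) ∷ f (P + 1) ∷ applyUpTo (λ j → f (P + suc (suc j))) T ∷ʳ f (P + suc (suc T)))
  applyUpTo-peak f P T = trans (applyUpTo-++ f P _)
    (cong (λ xs → applyUpTo f P ++ (f (P + 0) ∷ f (P + 1) ∷ xs)) (sym (applyUpTo-∷ʳ _ T)))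

  ++-injective-length : ∀ (xs xs′ : List A) {ys ys′} → length xs ≡ length xs′ →
    xs ++ ys ≡ xs′ ++ ys′ → xs ≡ xs′ × ys ≡ ys′
  ++-injective-length []       []         _   eq = refl , eq
  ++-injective-length (x ∷ xs) (x′ ∷ xs′) len eq with ∷-injective eq
  ... | refl , eq′ with ++-injective-length xs xs′ (suc-injective len) eq′
  ...   | refl , ys≡ys′ = refl , ys≡ys′

  applyUpTo⁻₁ : ∀ {R : A → A → Set} (f : ℕ → A) n → Linked R (applyUpTo f n) →
    ∀ {i} → suc i < n → R (f i) (f (suc i))
  applyUpTo⁻₁ f (suc (suc n)) (r ∷ _)  {zero}  _           = r
  applyUpTo⁻₁ f (suc (suc n)) (_ ∷ rs) {suc i} (s≤s 1+i<n) = applyUpTo⁻₁ (f ∘ suc) (suc n) rs 1+i<n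
  applyUpTo⁻₁ f (suc zero)    _        {i}     (s≤s ())

module OneLine {q} (π : Perm (suc (suc q))) where

  -- The 0-based values of π; the value 0 outside [0, q + 1] is junk.
  F : ℕ → ℕ
  F i with i <? suc (suc q)
  ... | yes i<n = toℕ (π ⟨$⟩ʳ fromℕ< i<n)
  ... | no  _   = 0

  F-fromℕ< : ∀ {i} (i<n : i < suc (suc q)) → F i ≡ toℕ (π ⟨$⟩ʳ fromℕ< i<n)
  F-fromℕ< {i} i<n with i <? suc (suc q)
  ... | yes _   = refl
  ... | no  i≮n = ⊥-elim (i≮n i<n)

  F-toℕ : ∀ x → F (toℕ x) ≡ toℕ (π ⟨$⟩ʳ x)
  F-toℕ x = trans (F-fromℕ< (toℕ<n x)) (cong (λ y → toℕ (π ⟨$⟩ʳ y)) (fromℕ<-toℕ x (toℕ<n x)))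

  isPermutation : IsPermutation (suc q) F
  isPermutation = record { bounded = bounded ; injective = injective ; surjective = surjective }
    where
    bounded : ∀ {i} → i ≤ suc q → F i ≤ suc q
    bounded i≤1+q = subst (_≤ suc q) (sym (F-fromℕ< (s≤s i≤1+q))) (≤-pred (toℕ<n _))
    injective : ∀ {i j} → i ≤ suc q → j ≤ suc q → F i ≡ F j → i ≡ j
    injective {i} {j} i≤1+q j≤1+q Fi≡Fj = begin
      i                                         ≡⟨ toℕ-fromℕ< (s≤s i≤1+q) ⟨
      toℕ (fromℕ< (s≤s i≤1+q))                  ≡⟨ cong toℕ (inverseˡ π) ⟨
      toℕ (π ⟨$⟩ˡ (π ⟨$⟩ʳ fromℕ< (s≤s i≤1+q)))  ≡⟨ cong (λ y → toℕ (π ⟨$⟩ˡ y)) πi≡πj ⟩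
      toℕ (π ⟨$⟩ˡ (π ⟨$⟩ʳ fromℕ< (s≤s j≤1+q)))  ≡⟨ cong toℕ (inverseˡ π) ⟩
      toℕ (fromℕ< (s≤s j≤1+q))                  ≡⟨ toℕ-fromℕ< (s≤s j≤1+q) ⟩
      j                                         ∎
      where
      open ≡-Reasoning
      πi≡πj = toℕ-injective (trans (sym (F-fromℕ< (s≤s i≤1+q))) (trans Fi≡Fj (F-fromℕ< (s≤s j≤1+q))))
    surjective : ∀ {v} → v ≤ suc q → ∃[ i ] i ≤ suc q × F i ≡ v
    surjective v≤1+q = toℕ x , ≤-pred (toℕ<n x) ,
      trans (F-toℕ x) (trans (cong toℕ (inverseʳ π)) (toℕ-fromℕ< (s≤s v≤1+q)))
      where x = π ⟨$⟩ˡ fromℕ< (s≤s v≤1+q)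

  last≡zero⇔ : π ⟨$⟩ʳ fromℕ (suc q) ≡ zero ⇔ F (suc q) ≡ 0
  last≡zero⇔ = mk⇔
    (λ π[last]≡0 → trans F[last]≡ (cong toℕ π[last]≡0))
    (λ F[last]≡0 → toℕ-injective (trans (sym F[last]≡) F[last]≡0))
    where
    F[last]≡ : F (suc q) ≡ toℕ (π ⟨$⟩ʳ fromℕ (suc q))
    F[last]≡ = trans (cong F (sym (toℕ-fromℕ (suc q)))) (F-toℕ (fromℕ (suc q)))

  sq-fromℕ< : ∀ {i} (i<n : i < suc (suc q)) → toℕ (sq π (fromℕ< i<n)) ≡ F (F i)
  sq-fromℕ< i<n = sym (trans (cong F (F-fromℕ< i<n)) (F-toℕ _))

  consecutive213Free⇔ : AvoidsConsec213 (sq π) ⇔ Consecutive213Free (suc q) (F ∘ F)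
  consecutive213Free⇔ = mk⇔
    (λ avoids i 2+i≤1+q b<a a<c → avoids (i , s≤s 2+i≤1+q ,
      subst₂ _<_ (sym (sq-fromℕ< (1+i<n (s≤s 2+i≤1+q)))) (sym (sq-fromℕ< (i<n (s≤s 2+i≤1+q)))) b<a ,
      subst₂ _<_ (sym (sq-fromℕ< (i<n (s≤s 2+i≤1+q)))) (sym (sq-fromℕ< (s≤s 2+i≤1+q))) a<c))
    (λ { c213 (i , 2+i<n , b<a , a<c) → c213 i (≤-pred 2+i<n)
      (subst₂ _<_ (sq-fromℕ< (1+i<n 2+i<n)) (sq-fromℕ< (i<n 2+i<n)) b<a)
      (subst₂ _<_ (sq-fromℕ< (i<n 2+i<n)) (sq-fromℕ< 2+i<n) a<c) })
    where
    1+i<n : ∀ {i} → suc (suc i) < suc (suc q) → suc i < suc (suc q)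
    1+i<n = <-trans (n<1+n _)
    i<n : ∀ {i} → suc (suc i) < suc (suc q) → i < suc (suc q)
    i<n = <-trans (n<1+n _) ∘ 1+i<n

  valleyFree⇒avoids : ValleyFree (suc q) F → (σ : Fin 3 → Fin 3) → σ 1F <ᶠ σ 0F → σ 1F <ᶠ σ 2F →
    Avoids (π ⟨$⟩ʳ_) σ
  valleyFree⇒avoids valleyFree σ σ1<σ0 σ1<σ2 (e , e↑ , ranked) =
    valleyFree (e↑ 0F 1F (s≤s z≤n)) (e↑ 1F 2F (s≤s (s≤s z≤n))) (≤-pred (toℕ<n (e 2F)))
      (value< 1F 0F σ1<σ0) (value< 1F 2F σ1<σ2)
    where
    value< : ∀ a b → σ a <ᶠ σ b → F (toℕ (e a)) < F (toℕ (e b))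
    value< a b σa<σb = subst₂ _<_ (sym (F-toℕ (e a))) (sym (F-toℕ (e b))) (proj₁ (ranked a b) σa<σb)

  valley-contains : ∀ {i j k} → i < j → j < k → k ≤ suc q → (σ : Fin 3 → Fin 3) (g : Fin 3 → ℕ) →
    StrictlyIncreasing g → (∀ a → F (triple i j k a) ≡ g (σ a)) → Contains (π ⟨$⟩ʳ_) σ
  valley-contains {i} {j} {k} i<j j<k k≤1+q σ g g↑ ranked =
    contains-by-ranking (π ⟨$⟩ʳ_) σ e g e↑ g↑ (λ a → trans (sym (F-fromℕ< (position<n a))) (ranked a))
    where
    position<n : ∀ a → triple i j k a < suc (suc q)
    position<n 0F = s≤s (<⇒≤ (<-trans i<j (<-≤-trans j<k k≤1+q)))
    position<n 1F = s≤s (<⇒≤ (<-≤-trans j<k k≤1+q))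
    position<n 2F = s≤s k≤1+q
    e : Fin 3 → Fin (suc (suc q))
    e a = fromℕ< (position<n a)
    e↑ : StrictlyIncreasing (toℕ ∘ e)
    e↑ a b a<b = subst₂ _<_ (sym (toℕ-fromℕ< (position<n a))) (sym (toℕ-fromℕ< (position<n b)))
                   (triple-increasing i<j j<k a b a<b)

  -- A valley is an occurrence of 213 or of 312, according to which of its ends is higher.
  avoids⇒valleyFree : Avoids (π ⟨$⟩ʳ_) p213 → Avoids (π ⟨$⟩ʳ_) p312 → ValleyFree (suc q) F
  avoids⇒valleyFree avoids213 avoids312 {i} {j} {k} i<j j<k k≤1+q Fj<Fi Fj<Fk with <-cmp (F i) (F k)
  ... | tri< Fi<Fk _ _ = avoids213 (valley-contains i<j j<k k≤1+q p213 (triple (F j) (F i) (F k))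
                           (triple-increasing Fj<Fi Fi<Fk) λ { 0F → refl ; 1F → refl ; 2F → refl })
  ... | tri≈ _ Fi≡Fk _ = <-irrefl (IsPermutation.injective isPermutation i≤1+q k≤1+q Fi≡Fk) i<k
    where
    i<k = <-trans i<j j<k
    i≤1+q = <⇒≤ (<-≤-trans i<k k≤1+q)
  ... | tri> _ _ Fk<Fi = avoids312 (valley-contains i<j j<k k≤1+q p312 (triple (F j) (F k) (F i))
                           (triple-increasing Fj<Fk Fk<Fi) λ { 0F → refl ; 1F → refl ; 2F → refl })

  Conditions : Set
  Conditions = Avoids (π ⟨$⟩ʳ_) p213 × Avoids (π ⟨$⟩ʳ_) p312 × AvoidsConsec213 (sq π) ×
               π ⟨$⟩ʳ fromℕ (suc q) ≡ zero

  conditions⇔ : Conditions ⇔ ((ValleyFree (suc q) F × Consecutive213Free (suc q) (F ∘ F)) × F (suc q) ≡ 0)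
  conditions⇔ = mk⇔
    (λ (avoids213 , avoids312 , avoidsConsec , last≡0) →
      (avoids⇒valleyFree avoids213 avoids312 , Equivalence.to consecutive213Free⇔ avoidsConsec) ,
      Equivalence.to last≡zero⇔ last≡0)
    (λ ((valleyFree , c213) , F-last) →
      valleyFree⇒avoids valleyFree p213 (s≤s z≤n) (s≤s z≤n) ,
      valleyFree⇒avoids valleyFree p312 (s≤s z≤n) (s≤s z≤n) ,
      Equivalence.from consecutive213Free⇔ c213 , Equivalence.from last≡zero⇔ F-last)

  value : ℕ → ℕ
  value = suc ∘ F

  word≡applyUpTo : word π ≡ applyUpTo value (suc (suc q))
  word≡applyUpTo = trans (map-tabulate id _) (tabulate-applyUpTo _ value (λ x → cong suc (sym (F-toℕ x))))

  RotationWord : Set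
  RotationWord = word π ≡ map (λ j → suc (suc j)) (upTo (suc q)) ++ (1 ∷ [])

  rotation-word⇔ : RotationWord ⇔ (Rotation q F × F (suc q) ≡ 0)
  rotation-word⇔ = mk⇔ to from
    where
    word≡init∷ʳlast : word π ≡ applyUpTo value (suc q) ∷ʳ value (suc q)
    word≡init∷ʳlast = trans word≡applyUpTo (sym (applyUpTo-∷ʳ value (suc q)))
    rotation≡ : map (λ j → suc (suc j)) (upTo (suc q)) ++ (1 ∷ []) ≡ applyUpTo (suc ∘ suc) (suc q) ∷ʳ 1
    rotation≡ = cong (_∷ʳ 1) (map-upTo (suc ∘ suc) (suc q))
    to : RotationWord → Rotation q F × F (suc q) ≡ 0
    to w = (λ j≤q → suc-injective (applyUpTo-injective value (suc ∘ suc) (suc q) (proj₁ parts) (s≤s j≤q))) ,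
           suc-injective (proj₂ parts)
      where
      parts = ∷ʳ-injective (applyUpTo value (suc q)) (applyUpTo (suc ∘ suc) (suc q))
                (trans (sym word≡init∷ʳlast) (trans w rotation≡))
    from : Rotation q F × F (suc q) ≡ 0 → RotationWord
    from (rotation , F-last) = trans word≡init∷ʳlast (trans (cong₂ _∷ʳ_ init≡ (cong suc F-last)) (sym rotation≡))
      where
      init≡ = applyUpTo-cong (suc q) (λ j<1+q → cong suc (rotation (≤-pred j<1+q)))

  PeakWord : Set
  PeakWord = Σ (List ℕ) λ σ → Σ (List ℕ) λ τ →
    Increasing σ × Decreasing τ × word π ≡ σ ++ (suc (suc q) ∷ suc q ∷ τ ++ (1 ∷ []))

  private
    +-suc-suc : ∀ m n → m + suc (suc n) ≡ suc (suc (m + n))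
    +-suc-suc m n = trans (+-suc m (suc n)) (cong suc (+-suc m n))

  word-peak-split : ∀ P T → suc q ≡ P + suc (suc T) → word π ≡
    applyUpTo value P ++
      (value (P + 0) ∷ value (P + 1) ∷ applyUpTo (λ j → value (P + suc (suc j))) T ∷ʳ value (P + suc (suc T)))
  word-peak-split P T 1+q≡ = trans word≡applyUpTo
    (trans (cong (applyUpTo value) (trans (cong suc 1+q≡) (sym (+-suc P (suc (suc T)))))) (applyUpTo-peak value P T))

  peakShape⇒word : PeakShape q F → F (suc q) ≡ 0 → PeakWord
  peakShape⇒word shape F-last = applyUpTo value P , applyUpTo H T , σ↑ , τ↓ ,
    trans (word-peak-split P T 1+q≡P+2+T) (cong (applyUpTo value P ++_)
      (cong₂ _∷_ (trans (cong value (+-identityʳ P)) (cong suc FP≡1+q))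
      (cong₂ _∷_ (trans (cong value (+-comm P 1)) (cong suc F[1+P]≡q))
                 (cong (applyUpTo H T ∷ʳ_) (trans (cong value (sym 1+q≡P+2+T)) (cong suc F-last))))))
    where
    open PeakShape shape renaming (peak to P; peak<q to P<q; at-peak to FP≡1+q; after-peak to F[1+P]≡q;
                                   ascending-before to σ-steps; descending-after to τ-steps)
    T = proj₁ (m≤n⇒∃[o]m+o≡n P<q)
    1+P+T≡q : suc (P + T) ≡ q
    1+P+T≡q = proj₂ (m≤n⇒∃[o]m+o≡n P<q)
    1+q≡P+2+T : suc q ≡ P + suc (suc T)
    1+q≡P+2+T = trans (cong suc (sym 1+P+T≡q)) (sym (+-suc-suc P T))
    H : ℕ → ℕ
    H j = value (P + suc (suc j))
    σ↑ : Increasing (applyUpTo value P)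
    σ↑ = applyUpTo⁺₁ value P (s≤s ∘ σ-steps)
    τ↓ : Decreasing (applyUpTo H T)
    τ↓ = applyUpTo⁺₁ H T λ {i} 2+i≤T →
      s≤s (subst (_< F (P + suc (suc i))) (cong F (sym (+-suc P (suc (suc i)))))
        (τ-steps (subst (suc (suc P) ≤_) (sym (+-suc-suc P i)) (s≤s (s≤s (m≤m+n P i))))
                 (subst (suc (P + suc (suc i)) ≤_) 1+P+T≡q (s≤s (+-monoʳ-≤ P 2+i≤T)))))

  word⇒peakShape : PeakWord → PeakShape q F × F (suc q) ≡ 0
  word⇒peakShape (σ , τ , σ↑ , τ↓ , w) = shape , F-last
    where
    P = length σ
    T = length τ
    H : ℕ → ℕ
    H j = value (P + suc (suc j))
    2+q≡P+3+T : suc (suc q) ≡ P + suc (suc (suc T))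
    2+q≡P+3+T = begin
      suc (suc q)                                        ≡⟨ length-applyUpTo value (suc (suc q)) ⟨
      length (applyUpTo value (suc (suc q)))             ≡⟨ cong length (trans (sym word≡applyUpTo) w) ⟩
      length (σ ++ (suc (suc q) ∷ suc q ∷ τ ++ (1 ∷ []))) ≡⟨ length-++ σ ⟩
      P + suc (suc (length (τ ++ (1 ∷ []))))             ≡⟨ cong (λ t → P + suc (suc t)) (length-++ τ) ⟩
      P + suc (suc (T + 1))                              ≡⟨ cong (λ t → P + suc (suc t)) (+-comm T 1) ⟩
      P + suc (suc (suc T))                              ∎
      where open ≡-Reasoning
    1+q≡P+2+T : suc q ≡ P + suc (suc T)
    1+q≡P+2+T = suc-injective (trans 2+q≡P+3+T (+-suc P (suc (suc T))))
    q≡P+1+T : q ≡ P + suc T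
    q≡P+1+T = suc-injective (trans 1+q≡P+2+T (+-suc P (suc T)))
    parts = ++-injective-length (applyUpTo value P) σ (length-applyUpTo value P)
              (trans (sym (word-peak-split P T 1+q≡P+2+T)) w)
    at-peak-parts = ∷-injective (proj₂ parts)
    after-peak-parts = ∷-injective (proj₂ at-peak-parts)
    tail-parts = ∷ʳ-injective (applyUpTo H T) τ (proj₂ after-peak-parts)
    F-last : F (suc q) ≡ 0
    F-last = suc-injective (trans (cong value 1+q≡P+2+T) (proj₂ tail-parts))
    shape : PeakShape q F
    shape = record
      { peak             = P
      ; peak<q           = subst (suc P ≤_) (sym q≡P+1+T) (m<m+n P z<s)
      ; at-peak          = suc-injective (trans (cong value (sym (+-identityʳ P))) (proj₁ at-peak-parts))
      ; after-peak       = suc-injective (trans (cong value (+-comm 1 P)) (proj₁ after-peak-parts))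
      ; ascending-before = λ 1+j<P → s≤s⁻¹ (applyUpTo⁻₁ value P (subst Increasing (sym (proj₁ parts)) σ↑) 1+j<P)
      ; descending-after = descending-after
      }
      where
      descending-after : ∀ {j} → suc P < j → j < q → F (suc j) < F j
      descending-after {j} 1+P<j j<q = s≤s⁻¹ (subst₂ _<_ (cong value P+3+i≡1+j) (cong value P+2+i≡j)
          (applyUpTo⁻₁ H T (subst Decreasing (sym (proj₁ tail-parts)) τ↓) 2+i≤T))
        where
        i = proj₁ (m≤n⇒∃[o]m+o≡n 1+P<j)
        P+2+i≡j : P + suc (suc i) ≡ j
        P+2+i≡j = trans (+-suc-suc P i) (proj₂ (m≤n⇒∃[o]m+o≡n 1+P<j))
        P+3+i≡1+j : P + suc (suc (suc i)) ≡ suc j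
        P+3+i≡1+j = trans (+-suc P (suc (suc i))) (cong suc P+2+i≡j)
        2+i≤T : suc (suc i) ≤ T
        2+i≤T = s≤s⁻¹ (+-cancelˡ-≤ P _ _ (subst₂ _≤_ (sym P+3+i≡1+j) q≡P+1+T j<q))

  word⇔shape : (RotationWord ⊎ PeakWord) ⇔ ((Rotation q F ⊎ PeakShape q F) × F (suc q) ≡ 0)
  word⇔shape = mk⇔
    [ map₁ inj₁ ∘ Equivalence.to rotation-word⇔ , map₁ inj₂ ∘ word⇒peakShape ]
    (λ where
      (inj₁ rotation , F-last) → inj₁ (Equivalence.from rotation-word⇔ (rotation , F-last))
      (inj₂ shape , F-last)    → inj₂ (peakShape⇒word shape F-last))

-- The bound n ≥ 3 only rules out n = 1; the characterisation holds for n = 2 as well.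
lemma3p3 : (m : ℕ) → 2 ≤ m → (π : Perm (suc m)) →
    ((Avoids (π ⟨$⟩ʳ_) p213 × Avoids (π ⟨$⟩ʳ_) p312 × AvoidsConsec213 (sq π) × π ⟨$⟩ʳ fromℕ m ≡ zero)
      ⇔
     (word π ≡ map (λ j → suc (suc j)) (upTo m) ++ (1 ∷ [])
       ⊎ Σ (List ℕ) λ σ → Σ (List ℕ) λ τ →
           Increasing σ × Decreasing τ × word π ≡ σ ++ (suc m ∷ m ∷ τ ++ (1 ∷ []))))
lemma3p3 (suc q) _ π = mk⇔
  (λ conditions → let (patternFree , F-last) = Equivalence.to conditions⇔ conditions in
    Equivalence.from word⇔shape (Equivalence.to (shape⇔ F-last) patternFree , F-last))
  (λ w → let (shape , F-last) = Equivalence.to word⇔shape w in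
    Equivalence.from conditions⇔ (Equivalence.from (shape⇔ F-last) shape , F-last))
  where
  open OneLine π
  shape⇔ : F (suc q) ≡ 0 →
    (ValleyFree (suc q) F × Consecutive213Free (suc q) (F ∘ F)) ⇔ (Rotation q F ⊎ PeakShape q F)
  shape⇔ = PeakAnalysis.patternFree⇔shape isPermutation
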